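{- Let $a,b$ be complex numbers and $n$ a nonnegative integer such that no zero factors occur in the denominators below. Then \[ \sum_{k=0}^{n}\frac{(a)_k(b-a)_k(-n)_k}{k!(\frac{b}{2})_k(-2n)_k} =\frac{a}{b}\frac{(\frac{2+a}{2})_n(\frac{1+b-a}{2})_n}{(\frac{1}{2})_n(\frac{2+b}{2})_n} +\frac{b-a}{b}\frac{(\frac{1+a}{2})_n(\frac{2+b-a}{2})_n}{(\frac{1}{2})_n(\frac{2+b}{2})_n}. \]
   Context: The shifted factorial is $(x)_0=1$, $(x)_k=x(x+1)\cdots(x+k-1)$ for $k\ge1$. The left-hand side is the terminating series ${}_3F_2\!\left[\begin{matrix}a,\ b-a,\ -n\\ \frac b2,\ -2n\end{matrix};1\right]$ (terms with $k>n$ vanish because of $(-n)_k$). -}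

module Defs where

open import Level using (Level; _⊔_) renaming (suc to lsuc)
open import Data.Nat using (ℕ; zero; suc)
open import Data.Nat.Combinatorics using ()
import Data.Nat as ℕ
open import Relation.Nullary using (¬_)
open import Algebra.Bundles using (CommutativeRing)

fromℕ : ∀ {c ℓ} (R : CommutativeRing c ℓ) → ℕ → CommutativeRing.Carrier R
fromℕ R zero    = CommutativeRing.0# R
fromℕ R (suc n) = CommutativeRing._+_ R (CommutativeRing.1# R) (fromℕ R n)

-- A field of characteristic zero, presented as a commutative ring with a
-- total inverse operation that is a genuine inverse on nonzero elements
-- (the value of 0⁻¹ is unconstrained and never used under the hypotheses),
-- and such that 1 + 1 + ... + 1 (suc n times) is never zero.
-- The complex numbers are an instance.
record Char0Field (c ℓ : Level) : Set (lsuc (c ⊔ ℓ)) where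
  field
    commutativeRing : CommutativeRing c ℓ
  open CommutativeRing commutativeRing public

  field
    _⁻¹      : Carrier → Carrier
    ⁻¹-cong  : ∀ {x y} → x ≈ y → x ⁻¹ ≈ y ⁻¹
    inverseʳ : ∀ x → ¬ (x ≈ 0#) → x * (x ⁻¹) ≈ 1#
    char0    : ∀ n → ¬ (fromℕ commutativeRing (suc n) ≈ 0#)

  infixl 7 _/_
  _/_ : Carrier → Carrier → Carrier
  x / y = x * (y ⁻¹)

module FieldOps {c ℓ : Level} (F : Char0Field c ℓ) where
  open Char0Field F hiding (zero)

  fromℕF : ℕ → Carrier
  fromℕF = fromℕ commutativeRing

  poch : Carrier → ℕ → Carrier
  poch x zero    = 1#
  poch x (suc k) = poch x k * (x + fromℕF k)

  sumTo : ℕ → (ℕ → Carrier) → Carrier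
  sumTo zero    f = f zero
  sumTo (suc n) f = sumTo n f + f (suc n)

  fact : ℕ → Carrier
  fact k = fromℕF (k ℕ.!)

  two : Carrier
  two = fromℕF 2

  denomL : Carrier → ℕ → ℕ → Carrier
  denomL b n k = fact k * poch (b / two) k * poch (- fromℕF (2 ℕ.* n)) k

  termL : Carrier → Carrier → ℕ → ℕ → Carrier
  termL a b n k =
    (poch a k * poch (b - a) k * poch (- fromℕF n) k) / denomL b n k

  lhs : Carrier → Carrier → ℕ → Carrier
  lhs a b n = sumTo n (termL a b n)

  denomR : Carrier → ℕ → Carrier
  denomR b n = poch (1# / two) n * poch ((two + b) / two) n

  rhs : Carrier → Carrier → ℕ → Carrier
  rhs a b n =
      (a / b) * ((poch ((two + a) / two) n * poch ((1# + b - a) / two) n) / denomR b n)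
    + ((b - a) / b) * ((poch ((1# + a) / two) n * poch ((two + b - a) / two) n) / denomR b n)

-- With β = b/2 and γ = β + 1, contiguity in the upper parameters
-- splits each term:  b T(a, b-a; β)_k = a T(a+1, b-a; γ)_k + (b-a) T(a, b-a+1; γ)_k
-- (the other parameters -n, -2n being fixed).  Both sums on the right are
-- instances, with (x, y) = (a+1, b-a) and (a, b-a+1), of the summation
--   3F2[x, y, -N ; (x+y+1)/2, -2N ; 1] = ((x+1)/2)_N ((y+1)/2)_N / ((1/2)_N ((x+y+1)/2)_N),
-- which is proved by induction on N: a WZ certificate shows by creative
-- telescoping that the sum for m+1 is the sum for m times the ratio of
-- consecutive closed forms.

module Submission where

open import Defs
open import Level using (Level)
open import Data.Nat as ℕ using (ℕ; zero; suc; _≤_; _<_; _≤′_; ≤′-refl; ≤′-step; z≤n; s≤s)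
open import Data.Integer as ℤ using (ℤ; +_; -[1+_]; _⊖_)
import Data.Integer.Properties as ℤP
import Data.Nat.Properties as ℕP
open import Data.Maybe using (Maybe; just; nothing)
open import Relation.Nullary using (¬_; yes; no)
import Relation.Binary.PropositionalEquality as P
open import Algebra.Bundles using (CommutativeRing)
import Algebra.Solver.Ring.AlmostCommutativeRing as ACR

-- The ring solver of the standard library with integer coefficients,
-- instantiated for an arbitrary commutative ring R.  It needs the
-- canonical map ℤ → R to be a ring homomorphism.
module IntegerCoefficients {c ℓ : Level} (R : CommutativeRing c ℓ) where
  open CommutativeRing R
  open import Algebra.Properties.Ring ring using (-‿involutive; -0#≈0#; -‿distribˡ-*; -‿distribʳ-*; -‿+-comm)
  open import Algebra.Properties.CommutativeSemigroup +-commutativeSemigroup using (interchange)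
  open import Algebra.Properties.Semiring.Mult.TCOptimised semiring using (_×_; ×-homo-+; ×1-homo-*)
  open import Relation.Binary.Reasoning.Setoid setoid

  -- n ↦ 1# + ... + 1#, in the variant with 1 × 1# = 1# definitionally,
  -- so that the constant 1 of the solver evaluates to 1# itself.
  natural : ℕ → Carrier
  natural n = n × 1#

  natural-suc : ∀ n → natural (suc n) ≈ 1# + natural n
  natural-suc n = ×-homo-+ 1# 1 n

  integer : ℤ → Carrier
  integer (+ n)    = natural n
  integer -[1+ n ] = - natural (suc n)

  integer-⊖ : ∀ m n → integer (m ⊖ n) ≈ natural m - natural n
  integer-⊖ m       zero    = sym (trans (+-congˡ -0#≈0#) (+-identityʳ _))
  integer-⊖ zero    (suc n) = sym (+-identityˡ _)
  integer-⊖ (suc m) (suc n) = begin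
    integer (suc m ⊖ suc n)           ≡⟨ P.cong integer (ℤP.[1+m]⊖[1+n]≡m⊖n m n) ⟩
    integer (m ⊖ n)                   ≈⟨ integer-⊖ m n ⟩
    natural m - natural n               ≈⟨ shift-difference 1# (natural m) (natural n) ⟨
    (1# + natural m) - (1# + natural n) ≈⟨ +-cong (natural-suc m) (-‿cong (natural-suc n)) ⟨
    natural (suc m) - natural (suc n)   ∎
    where
    shift-difference : ∀ a x y → (a + x) - (a + y) ≈ x - y
    shift-difference a x y = begin
      (a + x) - (a + y)   ≈⟨ +-congˡ (-‿+-comm a y) ⟨
      (a + x) + (- a - y) ≈⟨ interchange a x (- a) (- y) ⟩
      (a - a) + (x - y)   ≈⟨ +-congʳ (-‿inverseʳ a) ⟩
      0# + (x - y)        ≈⟨ +-identityˡ (x - y) ⟩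
      x - y               ∎

  integer-neg : ∀ i → integer (ℤ.- i) ≈ - integer i
  integer-neg -[1+ n ]  = sym (-‿involutive _)
  integer-neg (+ zero)  = sym -0#≈0#
  integer-neg (+ suc n) = refl

  integer-+ : ∀ i j → integer (i ℤ.+ j) ≈ integer i + integer j
  integer-+ -[1+ m ] -[1+ n ] = begin
    - natural (suc (suc (m ℕ.+ n)))        ≡⟨ P.cong (λ k → - natural (suc k)) (ℕP.+-suc m n) ⟨
    - natural (suc m ℕ.+ suc n)            ≈⟨ -‿cong (×-homo-+ 1# (suc m) (suc n)) ⟩
    - (natural (suc m) + natural (suc n))  ≈⟨ -‿+-comm _ _ ⟨
    - natural (suc m) - natural (suc n)    ∎
  integer-+ -[1+ m ] (+ n)    = trans (integer-⊖ n (suc m)) (+-comm _ _)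
  integer-+ (+ m)    -[1+ n ] = integer-⊖ m (suc n)
  integer-+ (+ m)    (+ n)    = ×-homo-+ 1# m n

  integer-*-pos : ∀ m j → integer (+ m ℤ.* j) ≈ natural m * integer j
  integer-*-pos m (+ n) = begin
    integer (+ m ℤ.* + n)   ≡⟨ P.cong integer (ℤP.pos-* m n) ⟨
    natural (m ℕ.* n)       ≈⟨ ×1-homo-* m n ⟩
    natural m * natural n   ∎
  integer-*-pos m -[1+ n ] = begin
    integer (+ m ℤ.* ℤ.- (+ suc n))     ≡⟨ P.cong integer (ℤP.neg-distribʳ-* (+ m) (+ suc n)) ⟨
    integer (ℤ.- (+ m ℤ.* + suc n))     ≈⟨ integer-neg (+ m ℤ.* + suc n) ⟩
    - integer (+ m ℤ.* + suc n)         ≈⟨ -‿cong (integer-*-pos m (+ suc n)) ⟩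
    - (natural m * natural (suc n))     ≈⟨ -‿distribʳ-* _ _ ⟩
    natural m * - natural (suc n)       ∎

  integer-* : ∀ i j → integer (i ℤ.* j) ≈ integer i * integer j
  integer-* (+ m)    j = integer-*-pos m j
  integer-* -[1+ m ] j = begin
    integer (ℤ.- (+ suc m) ℤ.* j)       ≡⟨ P.cong integer (ℤP.neg-distribˡ-* (+ suc m) j) ⟨
    integer (ℤ.- (+ suc m ℤ.* j))       ≈⟨ integer-neg (+ suc m ℤ.* j) ⟩
    - integer (+ suc m ℤ.* j)           ≈⟨ -‿cong (integer-*-pos (suc m) j) ⟩
    - (natural (suc m) * integer j)     ≈⟨ -‿distribˡ-* _ _ ⟩
    - natural (suc m) * integer j       ∎

  homomorphism : ℤ.+-*-rawRing ACR.-Raw-AlmostCommutative⟶ ACR.fromCommutativeRing R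
  homomorphism = record
    { ⟦_⟧    = integer
    ; +-homo = integer-+
    ; *-homo = integer-*
    ; -‿homo = integer-neg
    ; 0-homo = refl
    ; 1-homo = refl
    }

  -- equality of integer coefficients is decidable (only `just` answers
  -- are used by the solver)
  coefficient-equality : ∀ i j → Maybe (integer i ≈ integer j)
  coefficient-equality i j with i ℤP.≟ j
  ... | yes P.refl = just refl
  ... | no _       = nothing

  open import Algebra.Solver.Ring ℤ.+-*-rawRing (ACR.fromCommutativeRing R) homomorphism coefficient-equality public

module Hypergeometric {ℓ₁ ℓ₂ : Level} (F : Char0Field ℓ₁ ℓ₂) where
  open Char0Field F hiding (zero)
  open FieldOps F renaming (fromℕF to ι)
  open IntegerCoefficients commutativeRing using (solve; _:=_; _:+_; _:*_; :-_; _:-_; con; Polynomial)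
  open import Algebra.Properties.Semiring.Mult semiring using (_×_; ×-homo-+; ×1-homo-*)
  open import Algebra.Properties.Ring ring using (-‿involutive; -0#≈0#)
  open import Relation.Binary.Reasoning.Setoid setoid

  𝟙 : ∀ {n} → Polynomial n
  𝟙 = con (+ 1)

  Nonzero : Carrier → Set ℓ₂
  Nonzero x = ¬ (x ≈ 0#)

  *-nonzeroˡ : ∀ {x y} → Nonzero (x * y) → Nonzero x
  *-nonzeroˡ {x} {y} xy≉0 x≈0 = xy≉0 (trans (*-congʳ x≈0) (zeroˡ y))

  *-nonzeroʳ : ∀ {x y} → Nonzero (x * y) → Nonzero y
  *-nonzeroʳ {x} {y} xy≉0 y≈0 = xy≉0 (trans (*-congˡ y≈0) (zeroʳ x))

  *-/-cancel : ∀ {x y} → Nonzero y → (x * y) / y ≈ x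
  *-/-cancel {x} {y} y≉0 = begin
    (x * y) * y ⁻¹ ≈⟨ *-assoc x y (y ⁻¹) ⟩
    x * (y * y ⁻¹) ≈⟨ *-congˡ (inverseʳ y y≉0) ⟩
    x * 1#         ≈⟨ *-identityʳ x ⟩
    x              ∎

  /-*-cancel : ∀ {x y} → Nonzero y → (x / y) * y ≈ x
  /-*-cancel {x} {y} y≉0 = begin
    (x * y ⁻¹) * y ≈⟨ *-assoc x (y ⁻¹) y ⟩
    x * (y ⁻¹ * y) ≈⟨ *-congˡ (*-comm (y ⁻¹) y) ⟩
    x * (y * y ⁻¹) ≈⟨ *-assoc x y (y ⁻¹) ⟨
    (x * y) / y    ≈⟨ *-/-cancel y≉0 ⟩
    x              ∎

  *-cancelʳ : ∀ {x y z} → Nonzero z → x * z ≈ y * z → x ≈ y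
  *-cancelʳ {x} {y} {z} z≉0 xz≈yz = begin
    x          ≈⟨ *-/-cancel z≉0 ⟨
    (x * z) / z ≈⟨ *-congʳ xz≈yz ⟩
    (y * z) / z ≈⟨ *-/-cancel z≉0 ⟩
    y          ∎

  *-nonzero : ∀ {x y} → Nonzero x → Nonzero y → Nonzero (x * y)
  *-nonzero {x} {y} x≉0 y≉0 xy≈0 = x≉0 (*-cancelʳ y≉0 (trans xy≈0 (sym (zeroˡ y))))

  /-unique : ∀ {x y z} → Nonzero y → x ≈ z * y → x / y ≈ z
  /-unique y≉0 x≈zy = *-cancelʳ y≉0 (trans (/-*-cancel y≉0) x≈zy)

  fraction-transfer : ∀ {N N′ D D′ a b e f} → Nonzero D → Nonzero D′ →
    N′ * a ≈ N * b → D′ * e ≈ D * f → (N′ / D′) * (a * f) ≈ (N / D) * (b * e)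
  fraction-transfer {N} {N′} {D} {D′} {a} {b} {e} {f} D≉0 D′≉0 numerators denominators =
    *-cancelʳ D≉0 (begin
      ((N′ / D′) * (a * f)) * D  ≈⟨ solve 4 (λ T A F D → (T :* (A :* F)) :* D := (T :* A) :* (D :* F)) refl (N′ / D′) a f D ⟩
      ((N′ / D′) * a) * (D * f)  ≈⟨ *-congˡ denominators ⟨
      ((N′ / D′) * a) * (D′ * e) ≈⟨ solve 4 (λ T A D E → (T :* A) :* (D :* E) := (T :* D) :* (A :* E)) refl (N′ / D′) a D′ e ⟩
      ((N′ / D′) * D′) * (a * e) ≈⟨ *-congʳ (/-*-cancel D′≉0) ⟩
      N′ * (a * e)               ≈⟨ solve 3 (λ N A E → N :* (A :* E) := (N :* A) :* E) refl N′ a e ⟩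
      (N′ * a) * e               ≈⟨ *-congʳ numerators ⟩
      (N * b) * e                ≈⟨ *-congʳ (*-congʳ (/-*-cancel D≉0)) ⟨
      ((N / D) * D * b) * e      ≈⟨ solve 4 (λ T D B E → (T :* D :* B) :* E := (T :* (B :* E)) :* D) refl (N / D) D b e ⟩
      ((N / D) * (b * e)) * D    ∎)

  ι≈×1 : ∀ n → ι n ≈ n × 1#
  ι≈×1 zero    = refl
  ι≈×1 (suc n) = +-congˡ (ι≈×1 n)

  ι-+ : ∀ m n → ι (m ℕ.+ n) ≈ ι m + ι n
  ι-+ m n = trans (ι≈×1 (m ℕ.+ n)) (trans (×-homo-+ 1# m n) (sym (+-cong (ι≈×1 m) (ι≈×1 n))))

  ι-* : ∀ m n → ι (m ℕ.* n) ≈ ι m * ι n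
  ι-* m n = trans (ι≈×1 (m ℕ.* n)) (trans (×1-homo-* m n) (sym (*-cong (ι≈×1 m) (ι≈×1 n))))

  ι-double : ∀ n → ι (2 ℕ.* n) ≈ ι n + ι n
  ι-double n = trans (ι-+ n (n ℕ.+ 0)) (+-congˡ (trans (ι-+ n 0) (+-identityʳ (ι n))))

  ι-nonzero : ∀ n → .{{ℕ.NonZero n}} → Nonzero (ι n)
  ι-nonzero (suc n) = char0 n

  -- ι (a ∸ k) ≈ ι a - ι k for k ≤ a, hence ι a - ι k ≉ 0 for k < a
  ι-difference-nonzero : ∀ {k a} → k < a → Nonzero (ι a - ι k)
  ι-difference-nonzero {k} {a} k<a a-k≈0 = ι-nonzero (a ℕ.∸ k) {{a∸k≢0}} (begin
    ι (a ℕ.∸ k)                  ≈⟨ solve 2 (λ D K → D := (K :+ D) :- K) refl (ι (a ℕ.∸ k)) (ι k) ⟩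
    (ι k + ι (a ℕ.∸ k)) - ι k    ≈⟨ +-congʳ (ι-+ k (a ℕ.∸ k)) ⟨
    ι (k ℕ.+ (a ℕ.∸ k)) - ι k    ≡⟨ P.cong (λ j → ι j - ι k) (ℕP.m+[n∸m]≡n (ℕP.<⇒≤ k<a)) ⟩
    ι a - ι k                    ≈⟨ a-k≈0 ⟩
    0#                           ∎)
    where
    a∸k≢0 : ℕ.NonZero (a ℕ.∸ k)
    a∸k≢0 = ℕ.>-nonZero (ℕP.m<n⇒0<n∸m k<a)

  fact-nonzero : ∀ k → Nonzero (fact k)
  fact-nonzero k = ι-nonzero (k ℕ.!) {{k ℕP.!≢0}}

  1-nonzero : Nonzero 1#
  1-nonzero 1≈0 = char0 0 (trans (+-identityʳ 1#) 1≈0)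

  two≈1+1 : two ≈ 1# + 1#
  two≈1+1 = +-congˡ (+-identityʳ 1#)

  1+1-nonzero : Nonzero (1# + 1#)
  1+1-nonzero 1+1≈0 = char0 1 (trans two≈1+1 1+1≈0)

  half-double : ∀ x → (x / two) * (1# + 1#) ≈ x
  half-double x = trans (*-congˡ (sym two≈1+1)) (/-*-cancel (char0 1))

  poch-cong : ∀ {x y} k → x ≈ y → poch x k ≈ poch y k
  poch-cong zero    x≈y = refl
  poch-cong (suc k) x≈y = *-cong (poch-cong k x≈y) (+-congʳ x≈y)

  -- (z)_k (z + k) = z (z + 1)_k : both are (z)_{k+1}
  poch-shift : ∀ z k → poch z k * (z + ι k) ≈ z * poch (z + 1#) k
  poch-shift z zero    = solve 1 (λ z → 𝟙 :* (z :+ con (+ 0)) := z :* 𝟙) refl z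
  poch-shift z (suc k) = begin
    (poch z k * (z + ι k)) * (z + (1# + ι k))   ≈⟨ *-congʳ (poch-shift z k) ⟩
    (z * poch (z + 1#) k) * (z + (1# + ι k))
      ≈⟨ solve 3 (λ z P K → (z :* P) :* (z :+ (𝟙 :+ K)) := z :* (P :* ((z :+ 𝟙) :+ K))) refl z (poch (z + 1#) k) (ι k) ⟩
    z * (poch (z + 1#) k * ((z + 1#) + ι k))    ∎

  -- (z)_m divides (z)_n for m ≤ n, so nonvanishing passes to shorter products
  poch-nonzero-≤′ : ∀ z {m n} → m ≤′ n → Nonzero (poch z n) → Nonzero (poch z m)
  poch-nonzero-≤′ z ≤′-refl          z≉0 = z≉0
  poch-nonzero-≤′ z (≤′-step m≤′n)   z≉0 = poch-nonzero-≤′ z m≤′n (*-nonzeroˡ z≉0)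

  poch-nonzero-≤ : ∀ z {m n} → m ≤ n → Nonzero (poch z n) → Nonzero (poch z m)
  poch-nonzero-≤ z m≤n = poch-nonzero-≤′ z (ℕP.≤⇒≤′ m≤n)

  poch-factor-nonzero : ∀ z {m n} → m < n → Nonzero (poch z n) → Nonzero (z + ι m)
  poch-factor-nonzero z m<n z≉0 = *-nonzeroʳ (poch-nonzero-≤ z m<n z≉0)

  poch-negative-nonzero : ∀ N k → k ≤ N → Nonzero (poch (- ι N) k)
  poch-negative-nonzero N zero    _   = 1-nonzero
  poch-negative-nonzero N (suc k) k<N =
    *-nonzero (poch-negative-nonzero N k (ℕP.<⇒≤ k<N)) factor-nonzero
    where
    factor-nonzero : Nonzero (- ι N + ι k)
    factor-nonzero ≈0 = ι-difference-nonzero k<N (begin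
      ι N - ι k          ≈⟨ solve 2 (λ N K → N :- K := :- (:- N :+ K)) refl (ι N) (ι k) ⟩
      - (- ι N + ι k)    ≈⟨ -‿cong ≈0 ⟩
      - 0#               ≈⟨ -0#≈0# ⟩
      0#                 ∎)

  sumTo-cong : ∀ m {A B : ℕ → Carrier} → (∀ k → k ≤ m → A k ≈ B k) → sumTo m A ≈ sumTo m B
  sumTo-cong zero    A≈B = A≈B 0 z≤n
  sumTo-cong (suc m) A≈B =
    +-cong (sumTo-cong m (λ k k≤m → A≈B k (ℕP.m≤n⇒m≤1+n k≤m))) (A≈B (suc m) ℕP.≤-refl)

  sumTo-linear : ∀ m (A B : ℕ → Carrier) α β →
    sumTo m (λ k → α * A k + β * B k) ≈ α * sumTo m A + β * sumTo m B
  sumTo-linear zero    A B α β = refl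
  sumTo-linear (suc m) A B α β = begin
    sumTo m (λ k → α * A k + β * B k) + (α * A (suc m) + β * B (suc m))
      ≈⟨ +-congʳ (sumTo-linear m A B α β) ⟩
    (α * sumTo m A + β * sumTo m B) + (α * A (suc m) + β * B (suc m))
      ≈⟨ solve 6 (λ α β SA SB a b → (α :* SA :+ β :* SB) :+ (α :* a :+ β :* b) := α :* (SA :+ a) :+ β :* (SB :+ b))
                 refl α β (sumTo m A) (sumTo m B) (A (suc m)) (B (suc m)) ⟩
    α * (sumTo m A + A (suc m)) + β * (sumTo m B + B (suc m)) ∎

  sumTo-telescope : ∀ m (A B G : ℕ → Carrier) ρ → (∀ k → k ≤ m → A k ≈ ρ * B k + (G (suc k) - G k)) →
    sumTo m A ≈ ρ * sumTo m B + (G (suc m) - G 0)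
  sumTo-telescope zero    A B G ρ step = step 0 z≤n
  sumTo-telescope (suc m) A B G ρ step = begin
    sumTo m A + A (suc m)
      ≈⟨ +-cong (sumTo-telescope m A B G ρ (λ k k≤m → step k (ℕP.m≤n⇒m≤1+n k≤m))) (step (suc m) ℕP.≤-refl) ⟩
    (ρ * sumTo m B + (G (suc m) - G 0)) + (ρ * B (suc m) + (G (suc (suc m)) - G (suc m)))
      ≈⟨ solve 6 (λ r S b g₀ g₁ g₂ → (r :* S :+ (g₁ :- g₀)) :+ (r :* b :+ (g₂ :- g₁)) := r :* (S :+ b) :+ (g₂ :- g₀))
                 refl ρ (sumTo m B) (B (suc m)) (G 0) (G (suc m)) (G (suc (suc m))) ⟩
    ρ * (sumTo m B + B (suc m)) + (G (suc (suc m)) - G 0) ∎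

  numerator3 : (p q r : Carrier) → ℕ → Carrier
  numerator3 p q r k = poch p k * poch q k * poch r k

  denominator3 : (c d : Carrier) → ℕ → Carrier
  denominator3 c d k = fact k * poch c k * poch d k

  term3 : (p q r c d : Carrier) → ℕ → Carrier
  term3 p q r c d k = numerator3 p q r k / denominator3 c d k

  fraction-ratio : ∀ {N N′ D D′ b f} → Nonzero D → Nonzero D′ →
    N′ ≈ N * b → D′ ≈ D * f → (N′ / D′) * f ≈ (N / D) * b
  fraction-ratio {N} {N′} {D} {D′} {b} {f} D≉0 D′≉0 numerators denominators = begin
    (N′ / D′) * f        ≈⟨ *-congˡ (*-identityˡ f) ⟨
    (N′ / D′) * (1# * f) ≈⟨ fraction-transfer D≉0 D′≉0 (trans (*-identityʳ N′) numerators)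
                                                       (trans (*-identityʳ D′) denominators) ⟩
    (N / D) * (b * 1#)   ≈⟨ *-congˡ (*-identityʳ b) ⟩
    (N / D) * b          ∎

  term3-succ : ∀ p q r c d k → Nonzero (denominator3 c d (suc k)) →
    term3 p q r c d (suc k) * ((1# + ι k) * (c + ι k) * (d + ι k))
      ≈ term3 p q r c d k * ((p + ι k) * (q + ι k) * (r + ι k))
  term3-succ p q r c d k D′≉0 = fraction-ratio D≉0 D′≉0
      (solve 7 (λ P p Q q R r K → (P :* (p :+ K)) :* (Q :* (q :+ K)) :* (R :* (r :+ K))
                                  := (P :* Q :* R) :* ((p :+ K) :* (q :+ K) :* (r :+ K)))
             refl (poch p k) p (poch q k) q (poch r k) r (ι k))
      (begin
        fact (suc k) * (poch c k * (c + ι k)) * (poch d k * (d + ι k))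
          ≈⟨ *-congʳ (*-congʳ (ι-* (suc k) (k ℕ.!))) ⟩
        ((1# + ι k) * fact k) * (poch c k * (c + ι k)) * (poch d k * (d + ι k))
          ≈⟨ solve 6 (λ K F C c D d → ((𝟙 :+ K) :* F) :* (C :* (c :+ K)) :* (D :* (d :+ K))
                                      := (F :* C :* D) :* ((𝟙 :+ K) :* (c :+ K) :* (d :+ K)))
                   refl (ι k) (fact k) (poch c k) c (poch d k) d ⟩
        denominator3 c d k * ((1# + ι k) * (c + ι k) * (d + ι k)) ∎)
    where
    D≉0 : Nonzero (denominator3 c d k)
    D≉0 = *-nonzero (*-nonzero (fact-nonzero k) (*-nonzeroˡ (*-nonzeroʳ (*-nonzeroˡ D′≉0))))
                    (*-nonzeroˡ (*-nonzeroʳ D′≉0))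

  -- contiguity in the parameters: raising r by 1 and d by 2 multiplies the
  -- k-th term by the rational factor below, since (z)_k (z+k) = z (z+1)_k
  term3-shift : ∀ p q r c d {r′ d′} k → r + 1# ≈ r′ → (d + 1#) + 1# ≈ d′ →
    Nonzero (denominator3 c d k) → Nonzero (denominator3 c d′ k) →
    term3 p q r c d k * ((r + ι k) * (d * (d + 1#)))
      ≈ term3 p q r′ c d′ k * (r * ((d + ι k) * ((d + 1#) + ι k)))
  term3-shift p q r c d {r′} {d′} k r+1≈r′ d+2≈d′ D≉0 D′≉0 =
    fraction-transfer D′≉0 D≉0 numerators denominators
    where
    numerators : numerator3 p q r k * (r + ι k) ≈ numerator3 p q r′ k * r
    numerators = begin
      (poch p k * poch q k * poch r k) * (r + ι k) ≈⟨ *-assoc _ _ _ ⟩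
      (poch p k * poch q k) * (poch r k * (r + ι k)) ≈⟨ *-congˡ (poch-shift r k) ⟩
      (poch p k * poch q k) * (r * poch (r + 1#) k) ≈⟨ *-congˡ (*-congˡ (poch-cong k r+1≈r′)) ⟩
      (poch p k * poch q k) * (r * poch r′ k)
        ≈⟨ solve 4 (λ P Q r R → (P :* Q) :* (r :* R) := (P :* Q :* R) :* r) refl (poch p k) (poch q k) r (poch r′ k) ⟩
      numerator3 p q r′ k * r ∎
    denominators : denominator3 c d k * ((d + ι k) * ((d + 1#) + ι k)) ≈ denominator3 c d′ k * (d * (d + 1#))
    denominators = begin
      (fact k * poch c k * poch d k) * ((d + ι k) * ((d + 1#) + ι k))
        ≈⟨ solve 5 (λ F C D a b → (F :* C :* D) :* (a :* b) := (F :* C) :* ((D :* a) :* b)) refl _ _ _ _ _ ⟩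
      (fact k * poch c k) * ((poch d k * (d + ι k)) * ((d + 1#) + ι k))
        ≈⟨ *-congˡ (*-congʳ (poch-shift d k)) ⟩
      (fact k * poch c k) * ((d * poch (d + 1#) k) * ((d + 1#) + ι k))
        ≈⟨ *-congˡ (*-assoc _ _ _) ⟩
      (fact k * poch c k) * (d * (poch (d + 1#) k * ((d + 1#) + ι k)))
        ≈⟨ *-congˡ (*-congˡ (poch-shift (d + 1#) k)) ⟩
      (fact k * poch c k) * (d * ((d + 1#) * poch ((d + 1#) + 1#) k))
        ≈⟨ *-congˡ (*-congˡ (*-congˡ (poch-cong k d+2≈d′))) ⟩
      (fact k * poch c k) * (d * ((d + 1#) * poch d′ k))
        ≈⟨ solve 5 (λ F C d e D → (F :* C) :* (d :* (e :* D)) := (F :* C :* D) :* (d :* e)) refl _ _ _ _ _ ⟩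
      denominator3 c d′ k * (d * (d + 1#)) ∎

  -- The auxiliary summation
  --   3F2[x, y, -N ; (x+y+1)/2, -2N ; 1] = ((x+1)/2)_N ((y+1)/2)_N / ((1/2)_N ((x+y+1)/2)_N),
  -- with the halves given as elements h, u, v, c satisfying 2h = 1, 2u = x+1,
  -- 2v = y+1 and 2c = x+y+1.
  module HalfParameterSum (x y u v h c : Carrier)
      (h-half : h * (1# + 1#) ≈ 1#) (u-half : u * (1# + 1#) ≈ x + 1#)
      (v-half : v * (1# + 1#) ≈ y + 1#) (c-half : c * (1# + 1#) ≈ x + y + 1#) where

    t : ℕ → ℕ → Carrier
    t N = term3 x y (- ι N) c (- ι (2 ℕ.* N))

    closed : ℕ → Carrier
    closed N = (poch u N * poch v N) / (poch h N * poch c N)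

    shorter-nonzero : ∀ m → Nonzero (poch h (suc m) * poch c (suc m)) → Nonzero (poch h m * poch c m)
    shorter-nonzero m hc≉0 = *-nonzero (*-nonzeroˡ (*-nonzeroˡ hc≉0)) (*-nonzeroˡ (*-nonzeroʳ hc≉0))

    module Step (m : ℕ) (hc≉0 : Nonzero (poch h (suc m) * poch c (suc m))) where
      M : Carrier
      M = ι m

      -- s = x + y + 1 + 2m = 2(c + m), the factor shared by all certificate denominators
      s : Carrier
      s = x + y + 1# + (M + M)

      -- closed (m+1) / closed m
      ratio : Carrier
      ratio = ((u + M) * (v + M)) / ((h + M) * (c + M))

      -- 2m + 2 - j, the j-dependent part of the certificate's denominator
      gap : ℕ → Carrier
      gap j = (M + M + 1# + 1#) - ι j

      -- the WZ certificate: certificate j = t_{m+1}(j) j (1 - x - y - 2j) / ((2m+2-j) s)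
      certificate-numerator : ℕ → Carrier
      certificate-numerator j = ι j * (1# - x - y - (ι j + ι j))

      certificate : ℕ → Carrier
      certificate j = t (suc m) j * (certificate-numerator j / (gap j * s))

      c+M≉0 : Nonzero (c + M)
      c+M≉0 = *-nonzeroʳ (*-nonzeroʳ hc≉0)

      h+M≉0 : Nonzero (h + M)
      h+M≉0 = *-nonzeroʳ (*-nonzeroˡ hc≉0)

      s≈2[c+M] : s ≈ (c + M) * (1# + 1#)
      s≈2[c+M] = begin
        x + y + 1# + (M + M)       ≈⟨ +-congʳ c-half ⟨
        c * (1# + 1#) + (M + M)    ≈⟨ solve 2 (λ C M → C :* (𝟙 :+ 𝟙) :+ (M :+ M) := (C :+ M) :* (𝟙 :+ 𝟙)) refl c M ⟩
        (c + M) * (1# + 1#)        ∎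

      s≉0 : Nonzero s
      s≉0 s≈0 = *-nonzero c+M≉0 1+1-nonzero (trans (sym s≈2[c+M]) s≈0)

      denominator-nonzero : ∀ N {k} → k ≤ suc m → k ≤ 2 ℕ.* N → Nonzero (denominator3 c (- ι (2 ℕ.* N)) k)
      denominator-nonzero N {k} k≤1+m k≤2N =
        *-nonzero (*-nonzero (fact-nonzero k) (poch-nonzero-≤ c k≤1+m (*-nonzeroʳ hc≉0)))
                  (poch-negative-nonzero (2 ℕ.* N) k k≤2N)

      gap-nonzero : ∀ {j} → j ≤ suc m → Nonzero (gap j)
      gap-nonzero {j} j≤1+m gap≈0 = ι-difference-nonzero j<2m+2 (begin
        ι (2 ℕ.+ 2 ℕ.* m) - ι j              ≈⟨ +-congʳ (+-congˡ (+-congˡ (ι-double m))) ⟩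
        (1# + (1# + (M + M))) - ι j          ≈⟨ solve 2 (λ M J → (𝟙 :+ (𝟙 :+ (M :+ M))) :- J := (M :+ M :+ 𝟙 :+ 𝟙) :- J) refl M (ι j) ⟩
        (M + M + 1# + 1#) - ι j              ≈⟨ gap≈0 ⟩
        0#                                   ∎)
        where
        j<2m+2 : j < 2 ℕ.+ 2 ℕ.* m
        j<2m+2 = s≤s (ℕP.≤-trans j≤1+m (s≤s (ℕP.m≤m+n m (m ℕ.+ 0))))

      ratio-doubled : ratio * ((1# + (M + M)) * s) ≈ (x + 1# + (M + M)) * (y + 1# + (M + M))
      ratio-doubled = begin
        ratio * ((1# + (M + M)) * s)                         ≈⟨ *-congˡ (doubled h c h-half c-half) ⟨
        ratio * (((h + M) * (c + M)) * ((1# + 1#) * (1# + 1#))) ≈⟨ *-assoc _ _ _ ⟨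
        (ratio * ((h + M) * (c + M))) * ((1# + 1#) * (1# + 1#)) ≈⟨ *-congʳ (/-*-cancel (*-nonzero h+M≉0 c+M≉0)) ⟩
        ((u + M) * (v + M)) * ((1# + 1#) * (1# + 1#))        ≈⟨ doubled u v u-half v-half ⟩
        (x + 1# + (M + M)) * (y + 1# + (M + M))              ∎
        where
        doubled : ∀ a b {a₂ b₂} → a * (1# + 1#) ≈ a₂ → b * (1# + 1#) ≈ b₂ →
          ((a + M) * (b + M)) * ((1# + 1#) * (1# + 1#)) ≈ (a₂ + (M + M)) * (b₂ + (M + M))
        doubled a b {a₂} {b₂} a-half b-half = begin
          ((a + M) * (b + M)) * ((1# + 1#) * (1# + 1#))
            ≈⟨ solve 3 (λ A B M → ((A :+ M) :* (B :+ M)) :* ((𝟙 :+ 𝟙) :* (𝟙 :+ 𝟙))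
                                  := (A :* (𝟙 :+ 𝟙) :+ (M :+ M)) :* (B :* (𝟙 :+ 𝟙) :+ (M :+ M))) refl a b M ⟩
          (a * (1# + 1#) + (M + M)) * (b * (1# + 1#) + (M + M)) ≈⟨ *-cong (+-congʳ a-half) (+-congʳ b-half) ⟩
          (a₂ + (M + M)) * (b₂ + (M + M))                       ∎

      -- the lower parameters -(m+1) and -(2m+2) of t_{m+1}, written in terms of M
      z : Carrier
      z = - (1# + M)

      w : Carrier
      w = - ((1# + M) + (1# + M))

      w≈ : - ι (2 ℕ.* suc m) ≈ w
      w≈ = -‿cong (ι-double (suc m))

      certificate-cleared : ∀ j → j ≤ suc m → certificate j * (gap j * s) ≈ t (suc m) j * certificate-numerator j
      certificate-cleared j j≤1+m = trans (*-assoc _ _ _) (*-congˡ (/-*-cancel (*-nonzero (gap-nonzero j≤1+m) s≉0)))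

      certificate-zero : certificate 0 ≈ 0#
      certificate-zero = solve 3 (λ T X Y → T :* ((con (+ 0) :* X) :* Y) := con (+ 0))
                               refl (t (suc m) 0) (1# - x - y - (0# + 0#)) ((gap 0 * s) ⁻¹)

      -- at j = m+1 the certificate cancels the last term of the sum for m+1
      certificate-top : certificate (suc m) ≈ - t (suc m) (suc m)
      certificate-top = *-cancelʳ (*-nonzero (gap-nonzero ℕP.≤-refl) s≉0) (begin
        certificate (suc m) * (gap (suc m) * s)           ≈⟨ certificate-cleared (suc m) ℕP.≤-refl ⟩
        T * ((1# + M) * (1# - x - y - ((1# + M) + (1# + M))))
          ≈⟨ solve 4 (λ T x y M → T :* ((𝟙 :+ M) :* (𝟙 :- x :- y :- ((𝟙 :+ M) :+ (𝟙 :+ M))))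
                                  := (:- T) :* (((M :+ M :+ 𝟙 :+ 𝟙) :- (𝟙 :+ M)) :* (x :+ y :+ 𝟙 :+ (M :+ M)))) refl T x y M ⟩
        - T * (gap (suc m) * s)                            ∎)
        where
        T : Carrier
        T = t (suc m) (suc m)

      -- The WZ identity t_{m+1}(k) = ratio t_m(k) + certificate (k+1) - certificate k
      -- for k ≤ m.  All three pieces are multiplied by the nonzero
      -- W = (2m+2-k)(2m+1-k) s and expressed as multiples of t_{m+1}(k).
      module WZ (k : ℕ) (k≤m : k ≤ m) where
        K : Carrier
        K = ι k

        T₀ T₁ T₁′ : Carrier
        T₀  = t m k
        T₁  = t (suc m) k
        T₁′ = t (suc m) (suc k)

        W : Carrier
        W = gap k * gap (suc k) * s

        k≤1+m : k ≤ suc m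
        k≤1+m = ℕP.m≤n⇒m≤1+n k≤m

        k≤2m : k ≤ 2 ℕ.* m
        k≤2m = ℕP.≤-trans k≤m (ℕP.m≤m+n m (m ℕ.+ 0))

        k<2[m+1] : k < 2 ℕ.* suc m
        k<2[m+1] = ℕP.≤-trans (ℕP.n≤1+n _) (ℕP.≤-trans (s≤s (s≤s k≤2m)) (ℕP.≤-reflexive (P.sym (ℕP.*-suc 2 m))))

        W≉0 : Nonzero W
        W≉0 = *-nonzero (*-nonzero (gap-nonzero k≤1+m) (gap-nonzero (s≤s k≤m))) s≉0

        next-term : T₁′ * ((1# + K) * (c + K) * (w + K)) ≈ T₁ * ((x + K) * (y + K) * (z + K))
        next-term = begin
          T₁′ * ((1# + K) * (c + K) * (w + K))
            ≈⟨ *-congˡ (*-congˡ (+-congʳ w≈)) ⟨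
          T₁′ * ((1# + K) * (c + K) * (- ι (2 ℕ.* suc m) + K))
            ≈⟨ term3-succ x y z c (- ι (2 ℕ.* suc m)) k
                 (denominator-nonzero (suc m) (s≤s k≤m) k<2[m+1]) ⟩
          T₁ * ((x + K) * (y + K) * (z + K)) ∎

        previous-term : T₁ * ((z + K) * (w * (w + 1#))) ≈ T₀ * (z * ((w + K) * ((w + 1#) + K)))
        previous-term = begin
          T₁ * ((z + K) * (w * (w + 1#)))
            ≈⟨ *-congˡ (*-congˡ (*-cong w≈ (+-congʳ w≈))) ⟨
          T₁ * ((z + K) * (w′ * (w′ + 1#)))
            ≈⟨ term3-shift x y z c w′ k z+1≈-m w′+2≈-2m
                 (denominator-nonzero (suc m) k≤1+m (ℕP.<⇒≤ k<2[m+1]))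
                 (denominator-nonzero m k≤1+m k≤2m) ⟩
          T₀ * (z * ((w′ + K) * ((w′ + 1#) + K)))
            ≈⟨ *-congˡ (*-congˡ (*-cong (+-congʳ w≈) (+-congʳ (+-congʳ w≈)))) ⟩
          T₀ * (z * ((w + K) * ((w + 1#) + K))) ∎
          where
          w′ : Carrier
          w′ = - ι (2 ℕ.* suc m)
          z+1≈-m : z + 1# ≈ - M
          z+1≈-m = solve 1 (λ M → :- (𝟙 :+ M) :+ 𝟙 := :- M) refl M
          w′+2≈-2m : (w′ + 1#) + 1# ≈ - ι (2 ℕ.* m)
          w′+2≈-2m = begin
            (w′ + 1#) + 1# ≈⟨ +-congʳ (+-congʳ w≈) ⟩
            (w + 1#) + 1#  ≈⟨ solve 1 (λ M → (:- ((𝟙 :+ M) :+ (𝟙 :+ M)) :+ 𝟙) :+ 𝟙 := :- (M :+ M)) refl M ⟩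
            - (M + M)      ≈⟨ -‿cong (ι-double m) ⟨
            - ι (2 ℕ.* m)  ∎

        B : Carrier
        B = (x + 1# + (M + M)) * (y + 1# + (M + M))

        f : Carrier
        f = (x + K) * (y + K) * (z + K)

        -- ratio t_m(k) W, computed via previous-term after multiplying by z (1+2m) ≉ 0
        ratio-piece : (ratio * T₀) * W ≈ T₁ * (((1# + 1#) * B) * ((1# + M) - K))
        ratio-piece = *-cancelʳ Y≉0 (begin
          ((ratio * T₀) * W) * Y
            ≈⟨ solve 5 (λ r T s M K →
                 ((r :* T) :* (((M :+ M :+ 𝟙 :+ 𝟙) :- K) :* ((M :+ M :+ 𝟙 :+ 𝟙) :- (𝟙 :+ K)) :* s)) :* (:- (𝟙 :+ M) :* (𝟙 :+ (M :+ M)))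
                 := (r :* ((𝟙 :+ (M :+ M)) :* s))
                    :* (T :* (:- (𝟙 :+ M) :* ((:- ((𝟙 :+ M) :+ (𝟙 :+ M)) :+ K) :* ((:- ((𝟙 :+ M) :+ (𝟙 :+ M)) :+ 𝟙) :+ K)))))
               refl ratio T₀ s M K ⟩
          (ratio * ((1# + (M + M)) * s)) * (T₀ * (z * ((w + K) * ((w + 1#) + K))))
            ≈⟨ *-cong ratio-doubled (sym previous-term) ⟩
          B * (T₁ * ((z + K) * (w * (w + 1#))))
            ≈⟨ solve 4 (λ B T M K →
                 B :* (T :* ((:- (𝟙 :+ M) :+ K) :* (:- ((𝟙 :+ M) :+ (𝟙 :+ M)) :* (:- ((𝟙 :+ M) :+ (𝟙 :+ M)) :+ 𝟙))))
                 := (T :* (((𝟙 :+ 𝟙) :* B) :* ((𝟙 :+ M) :- K))) :* (:- (𝟙 :+ M) :* (𝟙 :+ (M :+ M))))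
               refl B T₁ M K ⟩
          (T₁ * (((1# + 1#) * B) * ((1# + M) - K))) * Y ∎)
          where
          Y : Carrier
          Y = z * (1# + (M + M))
          Y≉0 : Nonzero Y
          Y≉0 = *-nonzero (λ z≈0 → char0 m (trans (sym (-‿involutive _)) (trans (-‿cong z≈0) -0#≈0#)))
                          (λ 1+2m≈0 → char0 (2 ℕ.* m) (trans (+-congˡ (ι-double m)) 1+2m≈0))

        -- the certificate pieces: certificate j (2m+2-j) s = t_{m+1}(j) j (1-x-y-2j), and at
        -- j = k+1 the term t_{m+1}(k+1) is traded for t_{m+1}(k) by next-term
        lower-certificate-piece : certificate k * W ≈ T₁ * (certificate-numerator k * gap (suc k))
        lower-certificate-piece = begin
          certificate k * W
            ≈⟨ solve 4 (λ C g g′ s → C :* (g :* g′ :* s) := (C :* (g :* s)) :* g′) refl (certificate k) (gap k) (gap (suc k)) s ⟩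
          (certificate k * (gap k * s)) * gap (suc k) ≈⟨ *-congʳ (certificate-cleared k k≤1+m) ⟩
          (T₁ * certificate-numerator k) * gap (suc k) ≈⟨ *-assoc _ _ _ ⟩
          T₁ * (certificate-numerator k * gap (suc k)) ∎

        upper-certificate-piece : certificate (suc k) * W ≈ T₁ * ((1# + 1#) * f)
        upper-certificate-piece = begin
          certificate (suc k) * W
            ≈⟨ solve 4 (λ C g g′ s → C :* (g :* g′ :* s) := (C :* (g′ :* s)) :* g) refl (certificate (suc k)) (gap k) (gap (suc k)) s ⟩
          (certificate (suc k) * (gap (suc k) * s)) * gap k ≈⟨ *-congʳ (certificate-cleared (suc k) (s≤s k≤m)) ⟩
          (T₁′ * certificate-numerator (suc k)) * gap k
            ≈⟨ *-congʳ (solve 4 (λ T x y K → T :* ((𝟙 :+ K) :* (𝟙 :- x :- y :- ((𝟙 :+ K) :+ (𝟙 :+ K))))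
                                             := T :* (:- (𝟙 :+ K) :* ((x :+ y :+ 𝟙) :+ (K :+ K)))) refl T₁′ x y K) ⟩
          (T₁′ * (- (1# + K) * ((x + y + 1#) + (K + K)))) * gap k
            ≈⟨ *-congʳ (*-congˡ (*-congˡ (+-congʳ c-half))) ⟨
          (T₁′ * (- (1# + K) * (c * (1# + 1#) + (K + K)))) * gap k
            ≈⟨ solve 4 (λ T K c M → (T :* (:- (𝟙 :+ K) :* (c :* (𝟙 :+ 𝟙) :+ (K :+ K)))) :* ((M :+ M :+ 𝟙 :+ 𝟙) :- K)
                                    := (T :* ((𝟙 :+ K) :* (c :+ K) :* (:- ((𝟙 :+ M) :+ (𝟙 :+ M)) :+ K))) :* (𝟙 :+ 𝟙))
                 refl T₁′ K c M ⟩
          (T₁′ * ((1# + K) * (c + K) * (w + K))) * (1# + 1#) ≈⟨ *-congʳ next-term ⟩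
          (T₁ * f) * (1# + 1#) ≈⟨ solve 2 (λ T f → (T :* f) :* (𝟙 :+ 𝟙) := T :* ((𝟙 :+ 𝟙) :* f)) refl T₁ f ⟩
          T₁ * ((1# + 1#) * f) ∎

        -- combine the three pieces; what remains is a polynomial identity in x, y, m, k
        identity : T₁ ≈ ratio * T₀ + (certificate (suc k) - certificate k)
        identity = *-cancelʳ W≉0 (sym (begin
          (ratio * T₀ + (certificate (suc k) - certificate k)) * W
            ≈⟨ solve 4 (λ A B C W → (A :+ (B :- C)) :* W := A :* W :+ (B :* W :- C :* W)) refl (ratio * T₀) (certificate (suc k)) (certificate k) W ⟩
          (ratio * T₀) * W + (certificate (suc k) * W - certificate k * W)
            ≈⟨ +-cong ratio-piece (+-cong upper-certificate-piece (-‿cong lower-certificate-piece)) ⟩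
          T₁ * (((1# + 1#) * B) * ((1# + M) - K)) + (T₁ * ((1# + 1#) * f) - T₁ * (certificate-numerator k * gap (suc k)))
            ≈⟨ solve 5 (λ T x y M K →
                 T :* (((𝟙 :+ 𝟙) :* ((x :+ 𝟙 :+ (M :+ M)) :* (y :+ 𝟙 :+ (M :+ M)))) :* ((𝟙 :+ M) :- K))
                 :+ (T :* ((𝟙 :+ 𝟙) :* ((x :+ K) :* (y :+ K) :* (:- (𝟙 :+ M) :+ K)))
                     :- T :* ((K :* (𝟙 :- x :- y :- (K :+ K))) :* ((M :+ M :+ 𝟙 :+ 𝟙) :- (𝟙 :+ K))))
                 := T :* (((M :+ M :+ 𝟙 :+ 𝟙) :- K) :* ((M :+ M :+ 𝟙 :+ 𝟙) :- (𝟙 :+ K)) :* (x :+ y :+ 𝟙 :+ (M :+ M))))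
               refl T₁ x y M K ⟩
          T₁ * W ∎))

      closed-succ : ratio * closed m ≈ closed (suc m)
      closed-succ = sym (/-unique hc≉0 (sym (begin
        (ratio * closed m) * (poch h m * (h + M) * (poch c m * (c + M)))
          ≈⟨ solve 6 (λ r R p H q C → (r :* R) :* (p :* H :* (q :* C)) := (r :* (H :* C)) :* (R :* (p :* q)))
                     refl ratio (closed m) (poch h m) (h + M) (poch c m) (c + M) ⟩
        (ratio * ((h + M) * (c + M))) * (closed m * (poch h m * poch c m))
          ≈⟨ *-cong (/-*-cancel (*-nonzero h+M≉0 c+M≉0)) (/-*-cancel (shorter-nonzero m hc≉0)) ⟩
        ((u + M) * (v + M)) * (poch u m * poch v m)
          ≈⟨ solve 4 (λ U V p q → (U :* V) :* (p :* q) := p :* U :* (q :* V)) refl (u + M) (v + M) (poch u m) (poch v m) ⟩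
        poch u m * (u + M) * (poch v m * (v + M)) ∎)))

      -- summing the WZ identity over k ≤ m telescopes
      sum-succ : sumTo (suc m) (t (suc m)) ≈ ratio * sumTo m (t m)
      sum-succ = begin
        sumTo m (t (suc m)) + T
          ≈⟨ +-congʳ (sumTo-telescope m (t (suc m)) (t m) certificate ratio WZ.identity) ⟩
        (ratio * sumTo m (t m) + (certificate (suc m) - certificate 0)) + T
          ≈⟨ +-congʳ (+-congˡ (+-cong certificate-top (-‿cong certificate-zero))) ⟩
        (ratio * sumTo m (t m) + (- T - 0#)) + T
          ≈⟨ solve 2 (λ A T → (A :+ (:- T :- con (+ 0))) :+ T := A) refl (ratio * sumTo m (t m)) T ⟩
        ratio * sumTo m (t m) ∎
        where
        T : Carrier
        T = t (suc m) (suc m)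

    summation : ∀ n → Nonzero (poch h n * poch c n) → sumTo n (t n) ≈ closed n
    summation zero    hc≉0 = trans (/-unique D≉0 (solve 0 (𝟙 :* 𝟙 :* 𝟙 := 𝟙 :* ((𝟙 :+ con (+ 0)) :* 𝟙 :* 𝟙)) refl))
                                    (sym (/-unique hc≉0 (solve 0 (𝟙 :* 𝟙 := 𝟙 :* (𝟙 :* 𝟙)) refl)))
      where
      D≉0 : Nonzero (denominator3 c (- ι 0) 0)
      D≉0 = *-nonzero (*-nonzero (fact-nonzero 0) 1-nonzero) 1-nonzero
    summation (suc m) hc≉0 = begin
      sumTo (suc m) (t (suc m))  ≈⟨ sum-succ ⟩
      ratio * sumTo m (t m)      ≈⟨ *-congˡ (summation m (shorter-nonzero m hc≉0)) ⟩
      ratio * closed m           ≈⟨ closed-succ ⟩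
      closed (suc m)             ∎
      where open Step m hc≉0 using (ratio; sum-succ; closed-succ)

  term3-contiguous : ∀ p q r β γ d k → β + 1# ≈ γ → p + q ≈ β * (1# + 1#) →
    Nonzero (denominator3 β d k) → Nonzero (denominator3 γ d k) → Nonzero (β + ι k) →
    (p + q) * term3 p q r β d k ≈ p * term3 (p + 1#) q r γ d k + q * term3 p (q + 1#) r γ d k
  term3-contiguous p q r β γ d k β+1≈γ p+q≈2β D≉0 D′≉0 β+k≉0 = *-cancelʳ β+k≉0 (sym (begin
    (p * X + q * Y) * (β + K)
      ≈⟨ solve 5 (λ p q X Y B → (p :* X :+ q :* Y) :* B := X :* (p :* B) :+ Y :* (q :* B)) refl p q X Y (β + K) ⟩
    X * (p * (β + K)) + Y * (q * (β + K))
      ≈⟨ +-cong (fraction-transfer D≉0 D′≉0 (raised p q) denominators)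
                (fraction-transfer D≉0 D′≉0 (trans (swap (poch p k) (poch (q + 1#) k)) (trans (raised q p) (swap (poch q k) (poch p k)))) denominators) ⟩
    T * ((p + K) * β) + T * ((q + K) * β)
      ≈⟨ solve 5 (λ T p q K B → T :* ((p :+ K) :* B) :+ T :* ((q :+ K) :* B) := (T :* B) :* ((p :+ q) :+ (K :+ K))) refl T p q K β ⟩
    (T * β) * ((p + q) + (K + K))             ≈⟨ *-congˡ (+-congʳ p+q≈2β) ⟩
    (T * β) * (β * (1# + 1#) + (K + K))
      ≈⟨ solve 3 (λ T B K → (T :* B) :* (B :* (𝟙 :+ 𝟙) :+ (K :+ K)) := ((B :* (𝟙 :+ 𝟙)) :* T) :* (B :+ K)) refl T β K ⟩
    ((β * (1# + 1#)) * T) * (β + K)           ≈⟨ *-congʳ (*-congʳ p+q≈2β) ⟨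
    ((p + q) * T) * (β + K)                   ∎))
    where
    K T X Y : Carrier
    K = ι k
    T = term3 p q r β d k
    X = term3 (p + 1#) q r γ d k
    Y = term3 p (q + 1#) r γ d k

    swap : ∀ A B {R e} → A * B * R * e ≈ B * A * R * e
    swap A B = *-congʳ (*-congʳ (*-comm A B))

    raised : ∀ a b → numerator3 (a + 1#) b r k * a ≈ numerator3 a b r k * (a + K)
    raised a b = begin
      poch (a + 1#) k * poch b k * poch r k * a
        ≈⟨ solve 4 (λ A B R a → A :* B :* R :* a := (a :* A) :* B :* R) refl (poch (a + 1#) k) (poch b k) (poch r k) a ⟩
      (a * poch (a + 1#) k) * poch b k * poch r k ≈⟨ *-congʳ (*-congʳ (poch-shift a k)) ⟨
      (poch a k * (a + K)) * poch b k * poch r k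
        ≈⟨ solve 4 (λ A a B R → (A :* a) :* B :* R := (A :* B :* R) :* a) refl (poch a k) (a + K) (poch b k) (poch r k) ⟩
      numerator3 a b r k * (a + K) ∎

    denominators : denominator3 γ d k * β ≈ denominator3 β d k * (β + K)
    denominators = begin
      fact k * poch γ k * poch d k * β
        ≈⟨ solve 4 (λ F G D B → F :* G :* D :* B := F :* (B :* G) :* D) refl (fact k) (poch γ k) (poch d k) β ⟩
      fact k * (β * poch γ k) * poch d k      ≈⟨ *-congʳ (*-congˡ (*-congˡ (poch-cong k β+1≈γ))) ⟨
      fact k * (β * poch (β + 1#) k) * poch d k ≈⟨ *-congʳ (*-congˡ (poch-shift β k)) ⟨
      fact k * (poch β k * (β + K)) * poch d k
        ≈⟨ solve 4 (λ F P B D → F :* (P :* B) :* D := (F :* P :* D) :* B) refl (fact k) (poch β k) (β + K) (poch d k) ⟩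
      denominator3 β d k * (β + K) ∎

  divide-relation : ∀ {a b e T X Y} → Nonzero b → b * T ≈ a * X + e * Y → T ≈ (a / b) * X + (e / b) * Y
  divide-relation {a} {b} {e} {T} {X} {Y} b≉0 relation = *-cancelʳ b≉0 (begin
    T * b                                     ≈⟨ *-comm T b ⟩
    b * T                                     ≈⟨ relation ⟩
    a * X + e * Y                             ≈⟨ +-cong (*-congʳ (/-*-cancel b≉0)) (*-congʳ (/-*-cancel b≉0)) ⟨
    ((a / b) * b) * X + ((e / b) * b) * Y
      ≈⟨ solve 5 (λ A E B X Y → (A :* B) :* X :+ (E :* B) :* Y := (A :* X :+ E :* Y) :* B) refl (a / b) (e / b) b X Y ⟩
    ((a / b) * X + (e / b) * Y) * b           ∎)

  module Instances (a b : Carrier) where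
    private
      half : ∀ {p q} → p ≈ q → (p / two) * (1# + 1#) ≈ q
      half p≈q = trans (half-double _) p≈q

      two′ : ∀ {n} → Polynomial n
      two′ = 𝟙 :+ (𝟙 :+ con (+ 0))

    module X = HalfParameterSum (a + 1#) (b - a) ((two + a) / two) ((1# + b - a) / two) (1# / two) ((two + b) / two)
      (half refl)
      (half (solve 1 (λ a → two′ :+ a := a :+ 𝟙 :+ 𝟙) refl a))
      (half (solve 2 (λ a b → 𝟙 :+ b :- a := b :- a :+ 𝟙) refl a b))
      (half (solve 2 (λ a b → two′ :+ b := a :+ 𝟙 :+ (b :- a) :+ 𝟙) refl a b))

    module Y = HalfParameterSum a (b - a + 1#) ((1# + a) / two) ((two + b - a) / two) (1# / two) ((two + b) / two)
      (half refl)
      (half (solve 1 (λ a → 𝟙 :+ a := a :+ 𝟙) refl a))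
      (half (solve 2 (λ a b → two′ :+ b :- a := b :- a :+ 𝟙 :+ 𝟙) refl a b))
      (half (solve 2 (λ a b → two′ :+ b := a :+ (b :- a :+ 𝟙) :+ 𝟙) refl a b))

    module _ (n : ℕ) (b≉0 : Nonzero b) (denomL≉0 : ∀ k → k ≤ n → Nonzero (denomL b n k))
             (denomR≉0 : Nonzero (denomR b n)) where
      private
        β γ : Carrier
        β = b / two
        γ = (two + b) / two

        β+1≈γ : β + 1# ≈ γ
        β+1≈γ = *-cancelʳ 1+1-nonzero (begin
          (β + 1#) * (1# + 1#)        ≈⟨ solve 1 (λ B → (B :+ 𝟙) :* (𝟙 :+ 𝟙) := B :* (𝟙 :+ 𝟙) :+ (𝟙 :+ 𝟙)) refl β ⟩
          β * (1# + 1#) + (1# + 1#)   ≈⟨ +-cong (half-double b) (sym two≈1+1) ⟩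
          b + two                     ≈⟨ +-comm b two ⟩
          two + b                     ≈⟨ half-double (two + b) ⟨
          γ * (1# + 1#)               ∎)

        a+[b-a]≈2β : a + (b - a) ≈ β * (1# + 1#)
        a+[b-a]≈2β = trans (solve 2 (λ a b → a :+ (b :- a) := b) refl a b) (sym (half-double b))

        β+k≉0 : ∀ k → k ≤ n → Nonzero (β + ι k)
        β+k≉0 zero    _   β+0≈0 = b≉0 (begin
          b                     ≈⟨ half-double b ⟨
          β * (1# + 1#)         ≈⟨ *-congʳ (trans (sym (+-identityʳ β)) β+0≈0) ⟩
          0# * (1# + 1#)        ≈⟨ zeroˡ _ ⟩
          0#                    ∎)
        β+k≉0 (suc j) j<n β+k≈0 = poch-factor-nonzero γ j<n (*-nonzeroʳ denomR≉0) (begin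
          γ + ι j               ≈⟨ +-congʳ β+1≈γ ⟨
          (β + 1#) + ι j        ≈⟨ +-assoc β 1# (ι j) ⟩
          β + ι (suc j)         ≈⟨ β+k≈0 ⟩
          0#                    ∎)

        denominator-nonzero : ∀ k → k ≤ n → Nonzero (denominator3 γ (- ι (2 ℕ.* n)) k)
        denominator-nonzero k k≤n =
          *-nonzero (*-nonzero (fact-nonzero k) (poch-nonzero-≤ γ k≤n (*-nonzeroʳ denomR≉0)))
                    (poch-negative-nonzero (2 ℕ.* n) k (ℕP.≤-trans k≤n (ℕP.m≤m+n n (n ℕ.+ 0))))

      term-splitting : ∀ k → k ≤ n → termL a b n k ≈ (a / b) * X.t n k + ((b - a) / b) * Y.t n k
      term-splitting k k≤n = divide-relation b≉0 (begin
        b * termL a b n k               ≈⟨ *-congʳ (solve 2 (λ a b → a :+ (b :- a) := b) refl a b) ⟨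
        (a + (b - a)) * termL a b n k
          ≈⟨ term3-contiguous a (b - a) (- ι n) β γ (- ι (2 ℕ.* n)) k β+1≈γ a+[b-a]≈2β
                              (denomL≉0 k k≤n) (denominator-nonzero k k≤n) (β+k≉0 k k≤n) ⟩
        a * X.t n k + (b - a) * Y.t n k ∎)

lemma5 : {c ℓ : Level} (F : Char0Field c ℓ) →
    let open Char0Field F
        open FieldOps F
    in (a b : Carrier) (n : ℕ) →
       ¬ (b ≈ 0#) →
       (∀ k → k ≤ n → ¬ (denomL b n k ≈ 0#)) →
       ¬ (denomR b n ≈ 0#) →
       lhs a b n ≈ rhs a b n
-- split every term, sum both parts, and evaluate them by the auxiliary summation
lemma5 F a b n b≉0 denomL≉0 denomR≉0 = begin
  sumTo n (termL a b n)
    ≈⟨ sumTo-cong n (term-splitting n b≉0 denomL≉0 denomR≉0) ⟩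
  sumTo n (λ k → (a / b) * X.t n k + ((b - a) / b) * Y.t n k)
    ≈⟨ sumTo-linear n (X.t n) (Y.t n) (a / b) ((b - a) / b) ⟩
  (a / b) * sumTo n (X.t n) + ((b - a) / b) * sumTo n (Y.t n)
    ≈⟨ +-cong (*-congˡ (X.summation n denomR≉0)) (*-congˡ (Y.summation n denomR≉0)) ⟩
  rhs a b n ∎
  where
  open Char0Field F
  open FieldOps F
  open Hypergeometric F using (sumTo-cong; sumTo-linear; module Instances)
  open Instances a b
  open import Relation.Binary.Reasoning.Setoid setoid
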